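{- Let $t$ be an odd positive integer and $n$ a positive integer. For every odd positive divisor $k$ of $n$, there is exactly one representation of $n$ as the sum of a $k$-term arithmetic progression of integers with difference $t$, and there is exactly one representation of $n$ as the sum of a $(2n/k)$-term arithmetic progression of integers with difference $t$. Moreover, $\Phi_t(n) = 2 d_1(n)$.
   Context: For $k \in \mathbb{N}$, $t \in \mathbb{N}_0$, $a \in \mathbb{Z}$, let $s_{k,t}(a) = \sum_{i=0}^{k-1}(a+it)$. Define $\Phi_t(n) = |\{(k,a) \in \mathbb{N}\times\mathbb{Z} : s_{k,t}(a) = n\}|$, the number of representations of $n$ as the sum of a finite arithmetic progression of integers (of any positive length $k$, first term $a \in \mathbb{Z}$) with difference $t$. $d_1(n)$ denotes the number of odd positive divisors of $n$. -}

module Defs where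

open import Data.Nat as ℕ using (ℕ; zero; suc; _%_; _≤_)
open import Data.Nat.Divisibility using (_∣_; _∣?_)
open import Data.Integer as ℤ using (ℤ; +_)
open import Data.List using (List; foldr; map; upTo; filter; length)
open import Data.Product using (Σ; _×_)
open import Relation.Binary.PropositionalEquality using (_≡_)
open import Relation.Nullary.Decidable using (_×-dec_)

s : ℕ → ℕ → ℤ → ℤ
s k t a = foldr ℤ._+_ (+ 0) (map (λ i → a ℤ.+ (+ i) ℤ.* (+ t)) (upTo k))

Odd : ℕ → Set
Odd n = n % 2 ≡ 1

-- d₁(n): number of odd positive divisors of n (counted among 1..n; used for n ≥ 1)
d₁ : ℕ → ℕ
d₁ n = length (filter (λ d → (d ∣? n) ×-dec (d % 2 ℕ.≟ 1)) (map suc (upTo n)))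

Rep : ℕ → ℤ → Set
Rep t n = Σ ℕ λ k → Σ ℤ λ a → (1 ≤ k) × (s k t a ≡ n)

-- Since 2·s_{k,t}(a) = k·(2a + (k − 1)t), a representation (k, a) of n gives the
-- factorisation 2n = k·m with m = 2a + (k − 1)t, and k + m ≡ 2k − 1 is odd because t
-- is odd; conversely each factorisation 2n = k·m with k + m odd determines exactly one
-- integer a.  In such a factorisation exactly one factor is odd, and it is an odd
-- divisor of n; the odd divisor together with the choice of which factor it is
-- recovers the factorisation, so there are 2·d₁(n) of them.

module Submission where

open import Defs
open import Data.Nat as ℕ using (ℕ; zero; suc; _+_; _*_; _/_; _%_; _≤_; s≤s; z≤n; NonZero)
open import Data.Nat.Properties as ℕ using ()
open import Data.Nat.DivMod using (m*n%n≡0; [m+kn]%n≡m%n; m*n/n≡m)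
open import Data.Nat.Divisibility using (_∣_; _∣?_; divides; quotient; ∣⇒≤)
import Data.Nat.Tactic.RingSolver as ℕ-Ring
open import Data.Integer as ℤ using (ℤ; +_; -[1+_]; ∣_∣)
open import Data.Integer.Properties as ℤ using ()
open import Data.Integer.Tactic.RingSolver using (solve-∀)
open import Data.List using (List; _∷_; length; foldr; map; upTo; applyUpTo; filter)
open import Data.List.Properties using (map-applyUpTo; map-upTo; map-cong)
open import Data.List.Membership.Propositional using (_∈_)
open import Data.List.Membership.Propositional.Properties using (∈-filter⁺; ∈-filter⁻; ∈-map⁺; ∈-upTo⁺)
open import Data.List.Membership.Setoid.Properties using (unique⇒irrelevant)
open import Data.List.Relation.Unary.Unique.Propositional.Properties using (filter⁺; map⁺; upTo⁺)
open import Data.List.Relation.Unary.Any using (here; there; index)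
open import Data.Fin using (Fin; zero; suc)
open import Data.Fin.Properties using (+↔⊎)
open import Data.Product using (Σ; ∃; ∃!; _×_; _,_; proj₁; proj₂; map₂)
open import Data.Product.Function.Dependent.Propositional using (Σ-↔)
open import Data.Empty using (⊥-elim)
open import Data.Sum using (_⊎_; inj₁; inj₂)
open import Data.Sum.Function.Propositional using (_⊎-↔_)
open import Function.Base using (_∘_)
open import Function.Bundles using (_↔_; _⇔_; mk↔ₛ′; mk⇔; Equivalence)
open import Function.Construct.Identity using (↔-id)
open import Function.Properties.Inverse using (↔-trans)
open import Function.Related.Propositional using (module EquationalReasoning)
open import Relation.Nullary using (¬_; Irrelevant; contradiction; Dec; yes; no)
open import Relation.Nullary.Decidable using (_×-dec_)
open import Relation.Binary.PropositionalEquality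
open import Algebra.Properties.AbelianGroup ℤ.+-0-abelianGroup using (∙-cancelʳ)
import Axiom.UniquenessOfIdentityProofs as UIP

Σ-≡-irrelevant : ∀ {A : Set} {B : A → Set} → (∀ x → Irrelevant (B x)) →
                 {p q : Σ A B} → proj₁ p ≡ proj₁ q → p ≡ q
Σ-≡-irrelevant irr {x , b} {.x , c} refl = cong (x ,_) (irr x b c)

irrelevant-⇔⇒↔ : ∀ {A B : Set} → Irrelevant A → Irrelevant B → A ⇔ B → A ↔ B
irrelevant-⇔⇒↔ irrA irrB A⇔B = mk↔ₛ′ to from (λ _ → irrB _ _) (λ _ → irrA _ _)
  where open Equivalence A⇔B

ℤ-≡-irrelevant : {i j : ℤ} → Irrelevant (i ≡ j)
ℤ-≡-irrelevant = UIP.Decidable⇒UIP.≡-irrelevant ℤ._≟_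

data Parity : ℕ → Set where
  even : ∀ w → Parity (2 * w)
  odd  : ∀ w → Parity (1 + 2 * w)

parity : ∀ n → Parity n
parity zero = even 0
parity (suc n) with parity n
... | even w = odd w
... | odd w = subst Parity (2*[1+w]≡2+2*w w) (even (suc w))
  where
  2*[1+w]≡2+2*w : ∀ w → 2 * suc w ≡ 2 + 2 * w
  2*[1+w]≡2+2*w = ℕ-Ring.solve-∀

odd-1+2* : ∀ w → Odd (1 + 2 * w)
odd-1+2* w = trans (cong (λ x → suc x % 2) (ℕ.*-comm 2 w)) ([m+kn]%n≡m%n 1 w 2)

¬odd-2* : ∀ w → ¬ Odd (2 * w)
¬odd-2* w odd-2w with trans (sym (m*n%n≡0 w 2)) (trans (cong (_% 2) (ℕ.*-comm w 2)) odd-2w)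
... | ()

odd⇒1+2* : ∀ {n} → Odd n → ∃ λ w → n ≡ 1 + 2 * w
odd⇒1+2* {n} odd-n with parity n
... | even w = ⊥-elim (¬odd-2* w odd-n)
... | odd w = w , refl

¬odd⇒2* : ∀ {n} → ¬ Odd n → ∃ λ w → n ≡ 2 * w
¬odd⇒2* {n} ¬odd-n with parity n
... | even w = w , refl
... | odd w = ⊥-elim (¬odd-n (odd-1+2* w))

odd+odd⇒¬odd : ∀ {m n} → Odd m → Odd n → ¬ Odd (m + n)
odd+odd⇒¬odd {m} {n} odd-m odd-n with odd⇒1+2* {m} odd-m | odd⇒1+2* {n} odd-n
... | v , refl | w , refl = subst (¬_ ∘ Odd) (sym (sum≡2*[1+v+w] v w)) (¬odd-2* (1 + v + w))
  where
  sum≡2*[1+v+w] : ∀ v w → (1 + 2 * v) + (1 + 2 * w) ≡ 2 * (1 + v + w)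
  sum≡2*[1+v+w] = ℕ-Ring.solve-∀

even-of-odd-sum : ∀ {m n} → Odd m → Odd (m + n) → ∃ λ q → n ≡ 2 * q
even-of-odd-sum {m} {n} odd-m odd-m+n with parity n
... | even q = q , refl
... | odd q = ⊥-elim (odd+odd⇒¬odd {m} odd-m (odd-1+2* q) odd-m+n)

odd-of-odd-sum : ∀ {m n} → ¬ Odd m → Odd (m + n) → Odd n
odd-of-odd-sum {m} {n} ¬odd-m odd-m+n with ¬odd⇒2* {m} ¬odd-m | parity n
... | _ , _ | odd q = odd-1+2* q
... | w , refl | even q = ⊥-elim (¬odd-2* (w + q) (subst Odd (2w+2q≡2*[w+q] w q) odd-m+n))
  where
  2w+2q≡2*[w+q] : ∀ w q → 2 * w + 2 * q ≡ 2 * (w + q)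
  2w+2q≡2*[w+q] = ℕ-Ring.solve-∀

+[1+2*]≡1+2* : ∀ w → + (1 + 2 * w) ≡ + 1 ℤ.+ + 2 ℤ.* + w
+[1+2*]≡1+2* w = cong (ℤ._+_ (+ 1)) (ℤ.pos-* 2 w)

odd-of-+≡1+2* : ∀ {n} z → + n ≡ + 1 ℤ.+ + 2 ℤ.* z → Odd n
odd-of-+≡1+2* (+ w) eq = subst Odd (sym (ℤ.+-injective (trans eq (sym (+[1+2*]≡1+2* w))))) (odd-1+2* w)
odd-of-+≡1+2* -[1+ w ] eq = contradiction (trans eq 1+2*[-1-w]≡-[1+2w]) λ ()
  where
  1+2*[-1-w]≡-[1+2w] : + 1 ℤ.+ + 2 ℤ.* -[1+ w ] ≡ -[1+ 2 * w ]
  1+2*[-1-w]≡-[1+2w] = trans (ring (+ w)) (cong ℤ.-_ (sym (+[1+2*]≡1+2* w)))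
    where
    ring : ∀ w → + 1 ℤ.+ + 2 ℤ.* ℤ.- (+ 1 ℤ.+ w) ≡ ℤ.- (+ 1 ℤ.+ + 2 ℤ.* w)
    ring = solve-∀

s-suc : ∀ k t a → s (suc k) t a ≡ a ℤ.+ s k t (a ℤ.+ + t)
s-suc k t a = cong₂ ℤ._+_ (a+0*t≡a a (+ t)) (cong (foldr ℤ._+_ (+ 0)) shift)
  where
  term : ℤ → ℕ → ℤ
  term b i = b ℤ.+ + i ℤ.* + t

  a+0*t≡a : ∀ a t → a ℤ.+ + 0 ℤ.* t ≡ a
  a+0*t≡a = solve-∀

  term-suc : ∀ i → term a (suc i) ≡ term (a ℤ.+ + t) i
  term-suc i = ring a (+ t) (+ i)
    where
    ring : ∀ a t i → a ℤ.+ (+ 1 ℤ.+ i) ℤ.* t ≡ (a ℤ.+ t) ℤ.+ i ℤ.* t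
    ring = solve-∀

  shift : map (term a) (applyUpTo suc k) ≡ map (term (a ℤ.+ + t)) (upTo k)
  shift = begin
    map (term a) (applyUpTo suc k)       ≡⟨ map-applyUpTo suc (term a) k ⟩
    applyUpTo (term a ∘ suc) k           ≡⟨ map-upTo (term a ∘ suc) k ⟨
    map (term a ∘ suc) (upTo k)          ≡⟨ map-cong term-suc (upTo k) ⟩
    map (term (a ℤ.+ + t)) (upTo k)      ∎
    where open ≡-Reasoning

firstPlusLast : ℕ → ℕ → ℤ → ℤ
firstPlusLast k t a = + 2 ℤ.* a ℤ.+ (+ k ℤ.- + 1) ℤ.* + t

s-gauss : ∀ k t a → + 2 ℤ.* s k t a ≡ + k ℤ.* firstPlusLast k t a
s-gauss zero t a = refl
s-gauss (suc k) t a = begin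
  + 2 ℤ.* s (suc k) t a                                   ≡⟨ cong (+ 2 ℤ.*_) (s-suc k t a) ⟩
  + 2 ℤ.* (a ℤ.+ s k t (a ℤ.+ + t))                       ≡⟨ ℤ.*-distribˡ-+ (+ 2) a _ ⟩
  + 2 ℤ.* a ℤ.+ + 2 ℤ.* s k t (a ℤ.+ + t)                 ≡⟨ cong (ℤ._+_ (+ 2 ℤ.* a)) (s-gauss k t (a ℤ.+ + t)) ⟩
  + 2 ℤ.* a ℤ.+ + k ℤ.* firstPlusLast k t (a ℤ.+ + t)     ≡⟨ ring a (+ t) (+ k) ⟩
  + suc k ℤ.* firstPlusLast (suc k) t a                   ∎
  where
  open ≡-Reasoning
  ring : ∀ a t k → + 2 ℤ.* a ℤ.+ k ℤ.* (+ 2 ℤ.* (a ℤ.+ t) ℤ.+ (k ℤ.- + 1) ℤ.* t)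
                 ≡ (+ 1 ℤ.+ k) ℤ.* (+ 2 ℤ.* a ℤ.+ ((+ 1 ℤ.+ k) ℤ.- + 1) ℤ.* t)
  ring = solve-∀

s-injective : ∀ {k} t {a b} → 1 ≤ k → s k t a ≡ s k t b → a ≡ b
s-injective {suc k} t {a} {b} _ sa≡sb = ℤ.*-cancelˡ-≡ (+ 2) a b (∙-cancelʳ _ _ _ ends≡)
  where
  ends≡ : firstPlusLast (suc k) t a ≡ firstPlusLast (suc k) t b
  ends≡ = ℤ.*-cancelˡ-≡ (+ suc k) _ _
    (trans (sym (s-gauss (suc k) t a)) (trans (cong (+ 2 ℤ.*_) sa≡sb) (s-gauss (suc k) t b)))

RepOfLength : ℕ → ℤ → ℕ → Set
RepOfLength t n k = Σ ℤ λ a → (1 ≤ k) × (s k t a ≡ n)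

record OddSumFactors (n k m : ℕ) : Set where
  constructor mkOddSumFactors
  field
    product≡2n : k * m ≡ 2 * n
    odd-sum    : Odd (k + m)

OddSumCofactor : ℕ → ℕ → Set
OddSumCofactor n k = Σ ℕ (OddSumFactors n k)

OddSumFactorisation : ℕ → Set
OddSumFactorisation n = Σ ℕ (OddSumCofactor n)

RepOfLength-irrelevant : ∀ t n k → Irrelevant (RepOfLength t n k)
RepOfLength-irrelevant t n k (a , 1≤k , sa≡n) (b , 1≤k′ , sb≡n)
  with refl ← s-injective t {a} {b} 1≤k (trans sa≡n (sym sb≡n))
  = cong₂ (λ p q → a , p , q) (ℕ.≤-irrelevant 1≤k 1≤k′) (ℤ-≡-irrelevant sa≡n sb≡n)

cofactor-positive : ∀ {n k m} .{{_ : NonZero n}} → k * m ≡ 2 * n → 1 ≤ k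
cofactor-positive {n} {zero} {m} 0≡2n = contradiction (sym 0≡2n) (ℕ.≢-nonZero⁻¹ (2 * n) {{ℕ.m*n≢0 2 n}})
cofactor-positive {k = suc k} _ = s≤s z≤n

OddSumCofactor-irrelevant : ∀ n k .{{_ : NonZero n}} → Irrelevant (OddSumCofactor n k)
OddSumCofactor-irrelevant n k (m , mkOddSumFactors km≡2n odd-k+m) (m′ , mkOddSumFactors km′≡2n odd-k+m′)
  with s≤s z≤n ← cofactor-positive {n} {k} km≡2n
  with refl ← ℕ.*-cancelˡ-≡ m m′ k (trans km≡2n (sym km′≡2n))
  = cong₂ (λ p q → m , mkOddSumFactors p q) (ℕ.≡-irrelevant km≡2n km′≡2n) (ℕ.≡-irrelevant odd-k+m odd-k+m′)

+[1+k]*z≡+n⇒+∣z∣≡z : ∀ k z n → + suc k ℤ.* z ≡ + n → + ∣ z ∣ ≡ z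
+[1+k]*z≡+n⇒+∣z∣≡z k (+ _) n _ = refl

RepOfLength⇒OddSumCofactor : ∀ {t n k} → Odd t → RepOfLength t (+ n) k → OddSumCofactor n k
RepOfLength⇒OddSumCofactor {t} {n} {suc k} odd-t (a , _ , sum≡n) with odd⇒1+2* {t} odd-t
... | u , refl = ∣ E ∣ , mkOddSumFactors k*m≡2n (odd-of-+≡1+2* (a ℤ.+ + k ℤ.+ + u ℤ.* + k) k+m≡1+2z)
  where
  open ≡-Reasoning
  E : ℤ
  E = firstPlusLast (suc k) t a

  k*E≡2n : + suc k ℤ.* E ≡ + (2 * n)
  k*E≡2n = begin
    + suc k ℤ.* E      ≡⟨ s-gauss (suc k) t a ⟨
    + 2 ℤ.* s (suc k) t a ≡⟨ cong (+ 2 ℤ.*_) sum≡n ⟩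
    + 2 ℤ.* + n        ≡⟨ ℤ.pos-* 2 n ⟨
    + (2 * n)          ∎

  ∣E∣≡E : + ∣ E ∣ ≡ E
  ∣E∣≡E = +[1+k]*z≡+n⇒+∣z∣≡z k E (2 * n) k*E≡2n

  k*m≡2n : suc k * ∣ E ∣ ≡ 2 * n
  k*m≡2n = ℤ.+-injective (begin
    + (suc k * ∣ E ∣)      ≡⟨ ℤ.pos-* (suc k) ∣ E ∣ ⟩
    + suc k ℤ.* + ∣ E ∣    ≡⟨ cong (+ suc k ℤ.*_) ∣E∣≡E ⟩
    + suc k ℤ.* E          ≡⟨ k*E≡2n ⟩
    + (2 * n)              ∎)

  k+m≡1+2z : + (suc k + ∣ E ∣) ≡ + 1 ℤ.+ + 2 ℤ.* (a ℤ.+ + k ℤ.+ + u ℤ.* + k)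
  k+m≡1+2z = begin
    + (suc k + ∣ E ∣)      ≡⟨ ℤ.pos-+ (suc k) ∣ E ∣ ⟩
    + suc k ℤ.+ + ∣ E ∣    ≡⟨ cong (ℤ._+_ (+ suc k)) ∣E∣≡E ⟩
    + suc k ℤ.+ E          ≡⟨ cong (λ t → + suc k ℤ.+ (+ 2 ℤ.* a ℤ.+ (+ suc k ℤ.- + 1) ℤ.* t)) (+[1+2*]≡1+2* u) ⟩
    + suc k ℤ.+ (+ 2 ℤ.* a ℤ.+ (+ suc k ℤ.- + 1) ℤ.* (+ 1 ℤ.+ + 2 ℤ.* + u)) ≡⟨ ring a (+ k) (+ u) ⟩
    + 1 ℤ.+ + 2 ℤ.* (a ℤ.+ + k ℤ.+ + u ℤ.* + k) ∎
    where
    ring : ∀ a k u → (+ 1 ℤ.+ k) ℤ.+ (+ 2 ℤ.* a ℤ.+ ((+ 1 ℤ.+ k) ℤ.- + 1) ℤ.* (+ 1 ℤ.+ + 2 ℤ.* u))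
                   ≡ + 1 ℤ.+ + 2 ℤ.* (a ℤ.+ k ℤ.+ u ℤ.* k)
    ring = solve-∀

OddSumCofactor⇒RepOfLength : ∀ {t n k} .{{_ : NonZero n}} → Odd t → OddSumCofactor n k → RepOfLength t (+ n) k
OddSumCofactor⇒RepOfLength {n = n} {zero} _ (m , mkOddSumFactors 0≡2n _) with () ← cofactor-positive {n} {0} {m} 0≡2n
OddSumCofactor⇒RepOfLength {t} {n} {suc k} odd-t (m , mkOddSumFactors k*m≡2n odd-k+m)
  with odd⇒1+2* {t} odd-t | odd⇒1+2* {suc k + m} odd-k+m
... | u , refl | w , k+m≡1+2w = a , s≤s z≤n , sum≡n
  where
  open ≡-Reasoning
  -- the solution of 2a + k(1 + 2u) = m, using k + m = 2w
  a : ℤ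
  a = + w ℤ.- (+ k ℤ.+ + u ℤ.* + k)

  2w≡k+m : + 2 ℤ.* + w ≡ + k ℤ.+ + m
  2w≡k+m = begin
    + 2 ℤ.* + w    ≡⟨ ℤ.pos-* 2 w ⟨
    + (2 * w)      ≡⟨ cong +_ (ℕ.suc-injective k+m≡1+2w) ⟨
    + (k + m)      ≡⟨ ℤ.pos-+ k m ⟩
    + k ℤ.+ + m    ∎

  E≡m : firstPlusLast (suc k) t a ≡ + m
  E≡m = begin
    + 2 ℤ.* a ℤ.+ (+ suc k ℤ.- + 1) ℤ.* + t
      ≡⟨ cong (λ t → + 2 ℤ.* a ℤ.+ (+ suc k ℤ.- + 1) ℤ.* t) (+[1+2*]≡1+2* u) ⟩
    + 2 ℤ.* a ℤ.+ (+ suc k ℤ.- + 1) ℤ.* (+ 1 ℤ.+ + 2 ℤ.* + u)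
      ≡⟨ ring (+ w) (+ k) (+ u) ⟩
    + 2 ℤ.* + w ℤ.- + k  ≡⟨ cong (ℤ._- + k) 2w≡k+m ⟩
    + k ℤ.+ + m ℤ.- + k  ≡⟨ ring′ (+ k) (+ m) ⟩
    + m                  ∎
    where
    ring : ∀ w k u → + 2 ℤ.* (w ℤ.- (k ℤ.+ u ℤ.* k)) ℤ.+ ((+ 1 ℤ.+ k) ℤ.- + 1) ℤ.* (+ 1 ℤ.+ + 2 ℤ.* u)
                   ≡ + 2 ℤ.* w ℤ.- k
    ring = solve-∀
    ring′ : ∀ k m → k ℤ.+ m ℤ.- k ≡ m
    ring′ = solve-∀

  sum≡n : s (suc k) t a ≡ + n
  sum≡n = ℤ.*-cancelˡ-≡ (+ 2) _ _ (begin
    + 2 ℤ.* s (suc k) t a              ≡⟨ s-gauss (suc k) t a ⟩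
    + suc k ℤ.* firstPlusLast (suc k) t a ≡⟨ cong (+ suc k ℤ.*_) E≡m ⟩
    + suc k ℤ.* + m                    ≡⟨ ℤ.pos-* (suc k) m ⟨
    + (suc k * m)                      ≡⟨ cong +_ k*m≡2n ⟩
    + (2 * n)                          ≡⟨ ℤ.pos-* 2 n ⟩
    + 2 ℤ.* + n                        ∎)

Rep↔OddSumFactorisation : ∀ {t n} .{{_ : NonZero n}} → Odd t → Rep t (+ n) ↔ OddSumFactorisation n
Rep↔OddSumFactorisation {t} {n} odd-t = Σ-↔ (↔-id ℕ) λ {k} →
  irrelevant-⇔⇒↔ (RepOfLength-irrelevant t (+ n) k) (OddSumCofactor-irrelevant n k)
    (mk⇔ (RepOfLength⇒OddSumCofactor {t} {n} {k} odd-t) (OddSumCofactor⇒RepOfLength {t} {n} {k} odd-t))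

∃!-first-term : ∀ {t n k} .{{_ : NonZero n}} → Odd t → OddSumCofactor n k → ∃! _≡_ λ a → s k t a ≡ + n
∃!-first-term {t} {n} {k} odd-t cofactor with a , 1≤k , sa≡n ← OddSumCofactor⇒RepOfLength {t} {n} {k} odd-t cofactor =
  a , sa≡n , λ {b} sb≡n → s-injective t {a} {b} 1≤k (trans sa≡n (sym sb≡n))

OddDivisor : ℕ → Set
OddDivisor n = Σ ℕ λ d → d ∣ n × Odd d

odd⇒nonZero : ∀ {d} → Odd d → NonZero d
odd⇒nonZero {suc d} _ = _

∣×odd-irrelevant : ∀ n d → Irrelevant (d ∣ n × Odd d)
∣×odd-irrelevant n d (divides q n≡qd , odd-d) (divides q′ n≡q′d , odd-d′)
  with refl ← ℕ.*-cancelʳ-≡ q q′ d {{odd⇒nonZero {d} odd-d}} (trans (sym n≡qd) n≡q′d)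
  = cong₂ (λ e o → divides q e , o) (ℕ.≡-irrelevant n≡qd n≡q′d) (ℕ.≡-irrelevant odd-d odd-d′)

OddSumFactors-swap : ∀ {n k m} → OddSumFactors n k m → OddSumFactors n m k
OddSumFactors-swap {n} {k} {m} (mkOddSumFactors km≡2n odd-k+m) =
  mkOddSumFactors (trans (ℕ.*-comm m k) km≡2n) (subst Odd (ℕ.+-comm k m) odd-k+m)

cofactor-of-odd-divisor : ∀ {n d} (d∣n : d ∣ n) → Odd d → OddSumFactors n d (2 * quotient d∣n)
cofactor-of-odd-divisor {n} {d} (divides q n≡qd) odd-d with odd⇒1+2* {d} odd-d
... | w , refl = mkOddSumFactors (trans (ring (1 + 2 * w) q) (cong (2 *_) (sym n≡qd)))
                                 (subst Odd (sym (ring′ w q)) (odd-1+2* (w + q)))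
  where
  ring : ∀ d q → d * (2 * q) ≡ 2 * (q * d)
  ring = ℕ-Ring.solve-∀
  ring′ : ∀ w q → 1 + 2 * w + 2 * q ≡ 1 + 2 * (w + q)
  ring′ = ℕ-Ring.solve-∀

odd-factor-divides : ∀ {n k m} → OddSumFactors n k m → Odd k → k ∣ n
odd-factor-divides {n} {k} {m} (mkOddSumFactors km≡2n odd-k+m) odd-k with even-of-odd-sum {k} odd-k odd-k+m
... | q , refl = divides q (ℕ.*-cancelˡ-≡ n (q * k) 2 (trans (sym km≡2n) (ring k q)))
  where
  ring : ∀ k q → k * (2 * q) ≡ 2 * (q * k)
  ring = ℕ-Ring.solve-∀

factor≡2*quotient : ∀ {n k m} → OddSumFactors n k m → (m∣n : m ∣ n) → Odd m → k ≡ 2 * quotient m∣n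
factor≡2*quotient {n} {k} {m} (mkOddSumFactors km≡2n _) (divides q n≡qm) odd-m =
  ℕ.*-cancelʳ-≡ k (2 * q) m {{odd⇒nonZero {m} odd-m}}
    (trans km≡2n (trans (cong (2 *_) n≡qm) (sym (ℕ.*-assoc 2 q m))))

even-factor⇒odd-cofactor : ∀ {n k m} → OddSumFactors n k m → ¬ Odd k → Odd m
even-factor⇒odd-cofactor {k = k} (mkOddSumFactors _ odd-k+m) ¬odd-k = odd-of-odd-sum {k} ¬odd-k odd-k+m

OddSumFactorisation↔OddDivisor⊎OddDivisor : ∀ n .{{_ : NonZero n}} →
  OddSumFactorisation n ↔ (OddDivisor n ⊎ OddDivisor n)
OddSumFactorisation↔OddDivisor⊎OddDivisor n = mk↔ₛ′ to from to∘from from∘to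
  where
  to : OddSumFactorisation n → OddDivisor n ⊎ OddDivisor n
  to (k , m , factors) with k % 2 ℕ.≟ 1
  ... | yes odd-k = inj₁ (k , odd-factor-divides factors odd-k , odd-k)
  ... | no ¬odd-k = inj₂ (m , odd-factor-divides (OddSumFactors-swap factors) odd-m , odd-m)
    where
    odd-m : Odd m
    odd-m = even-factor⇒odd-cofactor factors ¬odd-k

  from : OddDivisor n ⊎ OddDivisor n → OddSumFactorisation n
  from (inj₁ (d , d∣n , odd-d)) = d , 2 * quotient d∣n , cofactor-of-odd-divisor d∣n odd-d
  from (inj₂ (d , d∣n , odd-d)) = 2 * quotient d∣n , d , OddSumFactors-swap (cofactor-of-odd-divisor d∣n odd-d)

  OddDivisor-≡ : {p q : OddDivisor n} → proj₁ p ≡ proj₁ q → p ≡ q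
  OddDivisor-≡ = Σ-≡-irrelevant (∣×odd-irrelevant n)

  OddSumFactorisation-≡ : {p q : OddSumFactorisation n} → proj₁ p ≡ proj₁ q → p ≡ q
  OddSumFactorisation-≡ = Σ-≡-irrelevant (λ k → OddSumCofactor-irrelevant n k)

  to∘from : ∀ x → to (from x) ≡ x
  to∘from (inj₁ (d , d∣n , odd-d)) with d % 2 ℕ.≟ 1
  ... | yes _ = cong inj₁ (OddDivisor-≡ refl)
  ... | no ¬odd-d = contradiction odd-d ¬odd-d
  to∘from (inj₂ (d , d∣n , odd-d)) with (2 * quotient d∣n) % 2 ℕ.≟ 1
  ... | yes odd-2q = contradiction odd-2q (¬odd-2* (quotient d∣n))
  ... | no _ = cong inj₂ (OddDivisor-≡ refl)

  from∘to : ∀ x → from (to x) ≡ x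
  from∘to (k , m , factors) with k % 2 ℕ.≟ 1
  ... | yes _ = OddSumFactorisation-≡ refl
  ... | no ¬odd-k = OddSumFactorisation-≡
    (sym (factor≡2*quotient factors (odd-factor-divides (OddSumFactors-swap factors) odd-m) odd-m))
    where
    odd-m : Odd m
    odd-m = even-factor⇒odd-cofactor factors ¬odd-k

Fin-length↔∃∈ : ∀ {A : Set} (xs : List A) → Fin (length xs) ↔ ∃ λ x → x ∈ xs
Fin-length↔∃∈ xs = mk↔ₛ′ (at xs) (index ∘ proj₂) at∘index (index∘at xs)
  where
  at : ∀ xs → Fin (length xs) → ∃ λ x → x ∈ xs
  at (x ∷ _)  zero    = x , here refl
  at (_ ∷ xs) (suc i) = map₂ there (at xs i)

  at∘index : ∀ {xs} (p : ∃ λ x → x ∈ xs) → at xs (index (proj₂ p)) ≡ p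
  at∘index (x , here refl) = refl
  at∘index (x , there x∈xs) = cong (map₂ there) (at∘index (x , x∈xs))

  index∘at : ∀ xs i → index (proj₂ (at xs i)) ≡ i
  index∘at (_ ∷ _)  zero    = refl
  index∘at (_ ∷ xs) (suc i) = cong suc (index∘at xs i)

Fin-d₁↔OddDivisor : ∀ n .{{_ : NonZero n}} → Fin (d₁ n) ↔ OddDivisor n
Fin-d₁↔OddDivisor n = ↔-trans (Fin-length↔∃∈ candidates)
  (Σ-↔ (↔-id ℕ) λ {d} → irrelevant-⇔⇒↔ (∈-candidates-irrelevant {d}) (∣×odd-irrelevant n d)
    (mk⇔ (proj₂ ∘ ∈-filter⁻ oddDivisor? {xs = map suc (upTo n)}) λ p → ∈-filter⁺ oddDivisor? (∈-1…n p) p))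
  where
  oddDivisor? : ∀ d → Dec (d ∣ n × Odd d)
  oddDivisor? d = (d ∣? n) ×-dec (d % 2 ℕ.≟ 1)

  candidates : List ℕ
  candidates = filter oddDivisor? (map suc (upTo n))

  ∈-candidates-irrelevant : ∀ {d} → Irrelevant (d ∈ candidates)
  ∈-candidates-irrelevant = unique⇒irrelevant (setoid ℕ) ℕ.≡-irrelevant
    (filter⁺ oddDivisor? {map suc (upTo n)} (map⁺ ℕ.suc-injective (upTo⁺ n)))

  ∈-1…n : ∀ {d} → d ∣ n × Odd d → d ∈ map suc (upTo n)
  ∈-1…n {suc d} (d∣n , _) = ∈-map⁺ suc (∈-upTo⁺ (∣⇒≤ d∣n))

Fin[2*m]↔Fin[m]⊎Fin[m] : ∀ m → Fin (2 * m) ↔ (Fin m ⊎ Fin m)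
Fin[2*m]↔Fin[m]⊎Fin[m] m = subst (λ x → Fin (2 * m) ↔ (Fin m ⊎ Fin x)) (ℕ.+-identityʳ m) (+↔⊎ {m})

theorem4 : (t n : ℕ) → Odd t → 1 ≤ n →
    ((k : ℕ) → .{{_ : NonZero k}} → Odd k → k ∣ n →
      (∃! _≡_ λ (a : ℤ) → s k t a ≡ + n)
      × (∃! _≡_ λ (a : ℤ) → s ((2 * n) / k) t a ≡ + n))
    × (Rep t (+ n) ↔ Fin (2 * d₁ n))
theorem4 t n odd-t 1≤n = unique-starts , counting
  where
  instance
    n≢0 : NonZero n
    n≢0 = ℕ.>-nonZero 1≤n

  unique-starts : (k : ℕ) → .{{_ : NonZero k}} → Odd k → k ∣ n →
    (∃! _≡_ λ (a : ℤ) → s k t a ≡ + n) × (∃! _≡_ λ (a : ℤ) → s ((2 * n) / k) t a ≡ + n)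
  unique-starts k odd-k k∣n@(divides q n≡qk) =
      ∃!-first-term {t} odd-t (_ , cofactor-of-odd-divisor k∣n odd-k)
    , subst (λ l → ∃! _≡_ λ a → s l t a ≡ + n) (sym 2n/k≡2q)
        (∃!-first-term {t} odd-t (_ , OddSumFactors-swap (cofactor-of-odd-divisor k∣n odd-k)))
    where
    2n/k≡2q : (2 * n) / k ≡ 2 * q
    2n/k≡2q = trans (cong (_/ k) (trans (cong (2 *_) n≡qk) (sym (ℕ.*-assoc 2 q k)))) (m*n/n≡m (2 * q) k)

  counting : Rep t (+ n) ↔ Fin (2 * d₁ n)
  counting = begin
    Rep t (+ n)                    ↔⟨ Rep↔OddSumFactorisation {t} odd-t ⟩
    OddSumFactorisation n          ↔⟨ OddSumFactorisation↔OddDivisor⊎OddDivisor n ⟩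
    (OddDivisor n ⊎ OddDivisor n)  ↔⟨ Fin-d₁↔OddDivisor n ⊎-↔ Fin-d₁↔OddDivisor n ⟨
    (Fin (d₁ n) ⊎ Fin (d₁ n))      ↔⟨ Fin[2*m]↔Fin[m]⊎Fin[m] (d₁ n) ⟨
    Fin (2 * d₁ n)                 ∎
    where open EquationalReasoning
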